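{- For all matroids $M$ and $N$ on disjoint ground sets, $$\mathrm{T}(M\mathbin{\Box} N)=\begin{cases}M\mathbin{\Box}\mathrm{T}N&\text{if }\rho(N)>0,\\ \mathrm{T}M\mathbin{\Box} N&\text{if }\rho(N)=0,\end{cases}\qquad \mathrm{L}(M\mathbin{\Box} N)=\begin{cases}\mathrm{L}M\mathbin{\Box} N&\text{if }\nu(M)>0,\\ M\mathbin{\Box}\mathrm{L}N&\text{if }\nu(M)=0.\end{cases}$$
   Context: For a matroid $M$ on $S$, $\rho(M)$ is its rank, $\nu(M)=|S|-\rho(M)$ its nullity, $\nu_M(A)=|A|-\rho_M(A)$, $\lambda_M(A)=\rho(M)-\rho_M(A)$. The free product $M\mathbin{\Box} N$ of $M$ on $S$ and $N$ on $T$ is the matroid on $S\cup T$ whose independent sets are the $A$ with $A\cap S$ independent in $M$ and $\lambda_M(A\cap S)\geq\nu_N(A\cap T)$. The truncation $\mathrm{T}M$ has as independent sets the independent sets $A$ of $M$ with $|A|\le\max\{0,\rho(M)-1\}$; the Higgs lift $\mathrm{L}M$ has as independent sets the $A\subseteq S$ with $\nu_M(A)\le1$. -}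

module Defs where

open import Data.Bool using (Bool; true; false; _∧_; if_then_else_)
open import Data.Nat using (ℕ; zero; suc; _∸_; _⊔_; _<_; _≤ᵇ_)
open import Data.Nat.Base using (_+_)
open import Data.List using (List; []; _∷_; _++_; map; foldr)
open import Data.Vec using (Vec; []; _∷_; take; drop)
open import Data.Fin.Subset using (Subset; ⊥; ⊤; ⁅_⁆; _∪_; _∈_; _∉_; _⊆_; ∣_∣)
open import Data.Product using (∃; _×_)
open import Relation.Binary.PropositionalEquality using (_≡_)

SetSystem : ℕ → Set
SetSystem n = Subset n → Bool

allSubsets : (n : ℕ) → List (Subset n)
allSubsets zero    = [] ∷ []
allSubsets (suc n) = map (true ∷_) (allSubsets n) ++ map (false ∷_) (allSubsets n)

_⊆ᵇ_ : ∀ {n} → Subset n → Subset n → Bool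
[]          ⊆ᵇ []       = true
(true ∷ a)  ⊆ᵇ (true ∷ b) = a ⊆ᵇ b
(true ∷ a)  ⊆ᵇ (false ∷ b) = false
(false ∷ a) ⊆ᵇ (_ ∷ b)  = a ⊆ᵇ b

rk : ∀ {n} → SetSystem n → Subset n → ℕ
rk {n} I A = foldr _⊔_ 0
  (map (λ B → if I B ∧ (B ⊆ᵇ A) then ∣ B ∣ else 0) (allSubsets n))

rank : ∀ {n} → SetSystem n → ℕ
rank I = rk I ⊤

nullity : ∀ {n} → SetSystem n → ℕ
nullity {n} I = n ∸ rank I

νₛ : ∀ {n} → SetSystem n → Subset n → ℕ
νₛ I A = ∣ A ∣ ∸ rk I A

λₛ : ∀ {n} → SetSystem n → Subset n → ℕ
λₛ I A = rank I ∸ rk I A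

-- Free product on the disjoint union Fin n ⊎ Fin m, realised as Fin (n + m)
-- (the first n elements are S, the last m are T).
_□_ : ∀ {n m} → SetSystem n → SetSystem m → SetSystem (n + m)
_□_ {n} I J A = I (take n A) ∧ (νₛ J (drop n A) ≤ᵇ λₛ I (take n A))

-- Truncation: independent with |A| ≤ max{0, ρ - 1} = ρ ∸ 1
Tr : ∀ {n} → SetSystem n → SetSystem n
Tr I A = I A ∧ (∣ A ∣ ≤ᵇ (rank I ∸ 1))

Lf : ∀ {n} → SetSystem n → SetSystem n
Lf I A = νₛ I A ≤ᵇ 1

record Matroid (n : ℕ) : Set where
  field
    indep      : SetSystem n
    indep-∅    : indep ⊥ ≡ true
    hereditary : ∀ A B → B ⊆ A → indep A ≡ true → indep B ≡ true
    augment    : ∀ A B → indep A ≡ true → indep B ≡ true → ∣ A ∣ < ∣ B ∣ →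
                 ∃ λ x → x ∈ B × x ∉ A × indep (A ∪ ⁅ x ⁆) ≡ true
open Matroid public

_≐_ : ∀ {n} → SetSystem n → SetSystem n → Set
I ≐ J = ∀ A → I A ≡ J A

{-# OPTIONS --safe #-}
module Submission where

-- Independence in M □ N of X ∪ Y (X ⊆ S, Y ⊆ T) amounts to X ∈ I(M) and |X| + |Y| ≤ ρ(M) + ρ_N(Y).
-- Together with the rank formulas
--   ρ_{M□N}(X ∪ Y) = min(ρ_M(X) + |Y|, ρ(M) + ρ_N(Y)),
--   ρ_{TM}(X) = min(ρ_M(X), ρ(M) ∸ 1),   ρ_{LM}(X) = min(ρ_M(X) + 1, |X|),
-- each of the four identities becomes an equivalence of inequalities between natural numbers.

open import Defs
open import Data.Bool using (Bool; true; false; _∧_; if_then_else_)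
open import Data.Bool.Properties using (T-≡; ⇔→≡)
open import Data.Nat using (ℕ; zero; suc; _+_; _∸_; _⊔_; _⊓_; _<_; _≤_; _≤ᵇ_; z≤n; s≤s)
open import Data.Nat.Properties
open import Data.List using (map)
open import Data.List.Membership.Propositional using () renaming (_∈_ to _∈ₗ_)
open import Data.List.Membership.Propositional.Properties
  using (∈-++⁺ˡ; ∈-++⁺ʳ; ∈-map⁺; ∈-map⁻; foldr-selective)
open import Data.List.Properties using (foldr-preservesᵇ; foldr-preservesᵒ)
import Data.List.Relation.Unary.All as All
import Data.List.Relation.Unary.Any as Any
open import Data.Vec using (Vec; []; _∷_; splitAt; take; drop; here) renaming (_++_ to _++ᵥ_)
open import Data.Fin.Subset using (Subset; ⊥; ⊤; _⊆_; ∣_∣)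
open import Data.Fin.Subset.Properties
  using (⊆-refl; ⊆-trans; ⊥⊆; ⊆⊤; drop-∷-⊆; s⊆s; out⊆; p⊆q⇒∣p∣≤∣q∣; ∣⊥∣≡0; ∣⊤∣≡n; ∣p∣≡n⇒p≡⊤)
open import Data.Product using (∃; _×_; _,_; proj₂)
open import Data.Sum using (_⊎_; inj₁; inj₂; [_,_])
open import Function using (_⇔_; mk⇔; Equivalence)
import Function.Properties.Equivalence as ⇔
open import Algebra.Properties.CommutativeSemigroup +-commutativeSemigroup using (xy∙z≈xz∙y)
open import Data.Product.Function.NonDependent.Propositional using (_×-⇔_)
open import Relation.Binary.PropositionalEquality
  using (_≡_; refl; sym; trans; cong; cong₂; subst; subst₂; module ≡-Reasoning)
open import Relation.Nullary using (Dec; yes; no)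

private variable
  n m : ℕ

∧≡true⇔ : {a b : Bool} → (a ∧ b) ≡ true ⇔ (a ≡ true × b ≡ true)
∧≡true⇔ {true}  = mk⇔ (refl ,_) proj₂
∧≡true⇔ {false} = mk⇔ (λ ()) (λ ())

≤ᵇ≡true⇔ : {a b : ℕ} → (a ≤ᵇ b) ≡ true ⇔ a ≤ b
≤ᵇ≡true⇔ {a} {b} = mk⇔ (λ e → ≤ᵇ⇒≤ a b (Equivalence.from T-≡ e)) (λ a≤b → Equivalence.to T-≡ (≤⇒≤ᵇ a≤b))

∸≤⇔≤+ : ∀ {a b c} → a ∸ b ≤ c ⇔ a ≤ b + c
∸≤⇔≤+ {a} {b} = mk⇔ (λ a∸b≤c → ≤-trans (m≤n+m∸n a b) (+-monoʳ-≤ b a∸b≤c)) (m≤n+o⇒m∸n≤o a b)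

∸≤∸⇔+≤+ : ∀ {x y r R} → x ≤ R → y ∸ r ≤ R ∸ x ⇔ x + y ≤ R + r
∸≤∸⇔+≤+ {x} {y} {r} {R} x≤R = ⇔.trans ∸≤⇔≤+
  (mk⇔ (λ y≤ → subst (x + y ≤_) shift (+-monoʳ-≤ x y≤))
       (λ x+y≤ → +-cancelˡ-≤ x _ _ (subst (x + y ≤_) (sym shift) x+y≤)))
  where
  shift : x + (r + (R ∸ x)) ≡ R + r
  shift = begin
    x + (r + (R ∸ x)) ≡⟨ cong (x +_) (+-comm r (R ∸ x)) ⟩
    x + ((R ∸ x) + r) ≡⟨ +-assoc x (R ∸ x) r ⟨
    x + (R ∸ x) + r   ≡⟨ cong (_+ r) (m+[n∸m]≡n x≤R) ⟩
    R + r             ∎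
    where open ≡-Reasoning

≤⊓+⇔ : ∀ {x} a b k → x ≤ a ⊓ b + k ⇔ (x ≤ a + k × x ≤ b + k)
≤⊓+⇔ a b k rewrite +-distribʳ-⊓ k a b =
  mk⇔ (λ x≤ → m≤n⊓o⇒m≤n _ _ x≤ , m≤n⊓o⇒m≤o _ _ x≤) (λ (x≤a , x≤b) → ⊓-glb x≤a x≤b)

⊆ᵇ⇒⊆ : {p q : Subset n} → (p ⊆ᵇ q) ≡ true → p ⊆ q
⊆ᵇ⇒⊆ {p = []}        {[]}        _ = ⊆-refl
⊆ᵇ⇒⊆ {p = true ∷ p}  {true ∷ q}  e = s⊆s (⊆ᵇ⇒⊆ e)
⊆ᵇ⇒⊆ {p = false ∷ p} {false ∷ q} e = s⊆s (⊆ᵇ⇒⊆ e)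
⊆ᵇ⇒⊆ {p = false ∷ p} {true ∷ q}  e = out⊆ (⊆ᵇ⇒⊆ e)

⊆⇒⊆ᵇ : {p q : Subset n} → p ⊆ q → (p ⊆ᵇ q) ≡ true
⊆⇒⊆ᵇ {p = []}        {[]}        _ = refl
⊆⇒⊆ᵇ {p = true ∷ p}  {true ∷ q}  p⊆q = ⊆⇒⊆ᵇ (drop-∷-⊆ p⊆q)
⊆⇒⊆ᵇ {p = true ∷ p}  {false ∷ q} p⊆q with () ← p⊆q here
⊆⇒⊆ᵇ {p = false ∷ p} {_ ∷ q}     p⊆q = ⊆⇒⊆ᵇ (drop-∷-⊆ p⊆q)

⊆ᵇ-++ : (p p′ : Subset n) (q q′ : Subset m) → ((p ++ᵥ q) ⊆ᵇ (p′ ++ᵥ q′)) ≡ (p ⊆ᵇ p′) ∧ (q ⊆ᵇ q′)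
⊆ᵇ-++ []          []          q q′ = refl
⊆ᵇ-++ (true ∷ p)  (true ∷ p′)  q q′ = ⊆ᵇ-++ p p′ q q′
⊆ᵇ-++ (true ∷ p)  (false ∷ p′) q q′ = refl
⊆ᵇ-++ (false ∷ p) (_ ∷ p′)     q q′ = ⊆ᵇ-++ p p′ q q′

++-⊆⁺ : {p p′ : Subset n} {q q′ : Subset m} → p ⊆ p′ → q ⊆ q′ → p ++ᵥ q ⊆ p′ ++ᵥ q′
++-⊆⁺ {p = p} {p′} {q} {q′} p⊆p′ q⊆q′ =
  ⊆ᵇ⇒⊆ (trans (⊆ᵇ-++ p p′ q q′) (cong₂ _∧_ (⊆⇒⊆ᵇ p⊆p′) (⊆⇒⊆ᵇ q⊆q′)))

++-⊆⁻ : (p p′ : Subset n) {q q′ : Subset m} → p ++ᵥ q ⊆ p′ ++ᵥ q′ → p ⊆ p′ × q ⊆ q′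
++-⊆⁻ p p′ {q} {q′} pq⊆ with Equivalence.to ∧≡true⇔ (trans (sym (⊆ᵇ-++ p p′ q q′)) (⊆⇒⊆ᵇ pq⊆))
... | p⊆ᵇp′ , q⊆ᵇq′ = ⊆ᵇ⇒⊆ p⊆ᵇp′ , ⊆ᵇ⇒⊆ q⊆ᵇq′

∣p++q∣≡∣p∣+∣q∣ : (p : Subset n) (q : Subset m) → ∣ p ++ᵥ q ∣ ≡ ∣ p ∣ + ∣ q ∣
∣p++q∣≡∣p∣+∣q∣ []          q = refl
∣p++q∣≡∣p∣+∣q∣ (true ∷ p)  q = cong suc (∣p++q∣≡∣p∣+∣q∣ p q)
∣p++q∣≡∣p∣+∣q∣ (false ∷ p) q = ∣p++q∣≡∣p∣+∣q∣ p q

⊤++⊤ : ∀ n m → ⊤ {n} ++ᵥ ⊤ {m} ≡ ⊤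
⊤++⊤ zero    m = refl
⊤++⊤ (suc n) m = cong (true ∷_) (⊤++⊤ n m)

∀-++ : {P : Subset (n + m) → Set} → (∀ p q → P (p ++ᵥ q)) → ∀ r → P r
∀-++ {n} P-++ r with splitAt n r
... | p , q , refl = P-++ p q

≐-from-⇔ : {K L : SetSystem (n + m)} → (∀ X Y → K (X ++ᵥ Y) ≡ true ⇔ L (X ++ᵥ Y) ≡ true) → K ≐ L
≐-from-⇔ {n} {K = K} {L} K⇔L = ∀-++ {n} {P = λ A → K A ≡ L A} (λ X Y → ⇔→≡ (K⇔L X Y))

take-++ : ∀ {A : Set} (xs : Vec A n) (ys : Vec A m) → take n (xs ++ᵥ ys) ≡ xs
take-++ []       ys = refl
take-++ (x ∷ xs) ys = cong (x ∷_) (take-++ xs ys)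

drop-++ : ∀ {A : Set} (xs : Vec A n) (ys : Vec A m) → drop n (xs ++ᵥ ys) ≡ ys
drop-++ []       ys = refl
drop-++ (x ∷ xs) ys = drop-++ xs ys

⊆-between : ∀ k {p q : Subset n} → p ⊆ q → ∣ p ∣ ≤ k → k ≤ ∣ q ∣ →
            ∃ λ r → p ⊆ r × r ⊆ q × ∣ r ∣ ≡ k
⊆-between k {[]} {[]} _ z≤n z≤n = [] , ⊆-refl , ⊆-refl , refl
⊆-between (suc k) {true ∷ p} {true ∷ q} p⊆q (s≤s p≤k) (s≤s k≤q)
  with r , p⊆r , r⊆q , ∣r∣≡k ← ⊆-between k (drop-∷-⊆ p⊆q) p≤k k≤q
  = true ∷ r , s⊆s p⊆r , s⊆s r⊆q , cong suc ∣r∣≡k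
⊆-between k {true ∷ p} {false ∷ q} p⊆q _ _ with () ← p⊆q here
⊆-between k {false ∷ p} {false ∷ q} p⊆q p≤k k≤q
  with r , p⊆r , r⊆q , ∣r∣≡k ← ⊆-between k (drop-∷-⊆ p⊆q) p≤k k≤q
  = false ∷ r , s⊆s p⊆r , s⊆s r⊆q , ∣r∣≡k
⊆-between k {false ∷ p} {true ∷ q} p⊆q p≤k k≤1+q with k ≤? ∣ q ∣
... | yes k≤q with r , p⊆r , r⊆q , ∣r∣≡k ← ⊆-between k (drop-∷-⊆ p⊆q) p≤k k≤q
  = false ∷ r , s⊆s p⊆r , out⊆ r⊆q , ∣r∣≡k
... | no k≰q = true ∷ q , out⊆ (drop-∷-⊆ p⊆q) , ⊆-refl , ≤-antisym (≰⇒> k≰q) k≤1+q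

⊆-shrink : ∀ k {q : Subset n} → k ≤ ∣ q ∣ → ∃ λ r → r ⊆ q × ∣ r ∣ ≡ k
⊆-shrink {n} k k≤q with r , _ , r⊆q , ∣r∣≡k ← ⊆-between k ⊥⊆ (subst (_≤ k) (sym (∣⊥∣≡0 n)) z≤n) k≤q
  = r , r⊆q , ∣r∣≡k

Hereditary : SetSystem n → Set
Hereditary I = ∀ {A B} → B ⊆ A → I A ≡ true → I B ≡ true

∈-allSubsets : (p : Subset n) → p ∈ₗ allSubsets n
∈-allSubsets []          = Any.here refl
∈-allSubsets (true ∷ p)  = ∈-++⁺ˡ (∈-map⁺ (true ∷_) (∈-allSubsets p))
∈-allSubsets (false ∷ p) = ∈-++⁺ʳ _ (∈-map⁺ (false ∷_) (∈-allSubsets p))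

module _ (I : SetSystem n) where

  private
    indepSize : Subset n → Subset n → ℕ
    indepSize A B = if I B ∧ (B ⊆ᵇ A) then ∣ B ∣ else 0

    indepSize-indep : ∀ {A B} → I B ≡ true → B ⊆ A → indepSize A B ≡ ∣ B ∣
    indepSize-indep {A} {B} iB B⊆A rewrite iB | ⊆⇒⊆ᵇ B⊆A = refl

    indepSize-cases : ∀ A B → (I B ≡ true × B ⊆ A × indepSize A B ≡ ∣ B ∣) ⊎ indepSize A B ≡ 0
    indepSize-cases A B with I B | B ⊆ᵇ A in B⊆A
    ... | true  | true  = inj₁ (refl , ⊆ᵇ⇒⊆ B⊆A , refl)
    ... | true  | false = inj₂ refl
    ... | false | _     = inj₂ refl

  indep⊆⇒∣∣≤rk : ∀ {A B} → I B ≡ true → B ⊆ A → ∣ B ∣ ≤ rk I A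
  indep⊆⇒∣∣≤rk {A} {B} iB B⊆A = foldr-preservesᵒ {P = ∣ B ∣ ≤_} {f = _⊔_}
    (λ x y → [ m≤n⇒m≤n⊔o y , m≤n⇒m≤o⊔n x ]) 0 (map (indepSize A) (allSubsets n))
    (inj₂ (Any.map (λ { refl → ≤-reflexive (sym (indepSize-indep iB B⊆A)) })
                   (∈-map⁺ (indepSize A) (∈-allSubsets B))))

  rk-lub : ∀ {A k} → (∀ B → I B ≡ true → B ⊆ A → ∣ B ∣ ≤ k) → rk I A ≤ k
  rk-lub {A} {k} bound = foldr-preservesᵇ ⊔-lub z≤n (All.tabulate indepSize≤k)
    where
    indepSize≤k : ∀ {x} → x ∈ₗ map (indepSize A) (allSubsets n) → x ≤ k
    indepSize≤k x∈ with B , _ , refl ← ∈-map⁻ (indepSize A) x∈ with indepSize-cases A B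
    ... | inj₁ (iB , B⊆A , e) = subst (_≤ k) (sym e) (bound B iB B⊆A)
    ... | inj₂ e              = subst (_≤ k) (sym e) z≤n

  rk-attained : I ⊥ ≡ true → ∀ A → ∃ λ B → I B ≡ true × B ⊆ A × ∣ B ∣ ≡ rk I A
  rk-attained i⊥ A with foldr-selective ⊔-sel 0 (map (indepSize A) (allSubsets n))
  ... | inj₁ rk≡0 = ⊥ , i⊥ , ⊥⊆ , trans (∣⊥∣≡0 n) (sym rk≡0)
  ... | inj₂ rk∈ with B , _ , rk≡ ← ∈-map⁻ (indepSize A) rk∈ with indepSize-cases A B
  ...   | inj₁ (iB , B⊆A , e) = B , iB , B⊆A , sym (trans rk≡ e)
  ...   | inj₂ e              = ⊥ , i⊥ , ⊥⊆ , trans (∣⊥∣≡0 n) (sym (trans rk≡ e))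

  rk≤∣∣ : ∀ A → rk I A ≤ ∣ A ∣
  rk≤∣∣ A = rk-lub (λ _ _ → p⊆q⇒∣p∣≤∣q∣)

  rk-mono : ∀ {A A′} → A ⊆ A′ → rk I A ≤ rk I A′
  rk-mono A⊆A′ = rk-lub (λ _ iB B⊆A → indep⊆⇒∣∣≤rk iB (⊆-trans B⊆A A⊆A′))

  rk≤rank : ∀ A → rk I A ≤ rank I
  rk≤rank A = rk-mono ⊆⊤

  indep⇒rk≡∣∣ : ∀ {A} → I A ≡ true → rk I A ≡ ∣ A ∣
  indep⇒rk≡∣∣ {A} iA = ≤-antisym (rk≤∣∣ A) (indep⊆⇒∣∣≤rk iA ⊆-refl)

  indep⇒∣∣≤rank : ∀ {A} → I A ≡ true → ∣ A ∣ ≤ rank I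
  indep⇒∣∣≤rank iA = indep⊆⇒∣∣≤rk iA ⊆⊤

  rank≤n : rank I ≤ n
  rank≤n = subst (rank I ≤_) (∣⊤∣≡n n) (rk≤∣∣ ⊤)

  nullity≡0⇒indep : I ⊥ ≡ true → Hereditary I → nullity I ≡ 0 → ∀ A → I A ≡ true
  nullity≡0⇒indep i⊥ hered ν≡0 A with W , iW , _ , ∣W∣≡rank ← rk-attained i⊥ ⊤ =
    hered ⊆⊤ (subst (λ W → I W ≡ true) (∣p∣≡n⇒p≡⊤ ∣W∣≡n) iW)
    where
    ∣W∣≡n : ∣ W ∣ ≡ n
    ∣W∣≡n = trans ∣W∣≡rank (≤-antisym rank≤n (m∸n≡0⇒m≤n ν≡0))

module _ (I : SetSystem n) where

  Tr-indep⇔ : ∀ {A} → Tr I A ≡ true ⇔ (I A ≡ true × ∣ A ∣ ≤ rank I ∸ 1)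
  Tr-indep⇔ = ⇔.trans ∧≡true⇔ (⇔.refl ×-⇔ ≤ᵇ≡true⇔)

  Lf-indep⇔ : ∀ {A} → Lf I A ≡ true ⇔ ∣ A ∣ ≤ rk I A + 1
  Lf-indep⇔ {A} = ⇔.trans ≤ᵇ≡true⇔ (∸≤⇔≤+ {b = rk I A})

module _ (I : SetSystem n) (J : SetSystem m) where

  □-++ : ∀ X Y → (I □ J) (X ++ᵥ Y) ≡ I X ∧ (νₛ J Y ≤ᵇ λₛ I X)
  □-++ X Y rewrite take-++ X Y | drop-++ X Y = refl

  □-indep⇔ : ∀ X Y → (I □ J) (X ++ᵥ Y) ≡ true ⇔ (I X ≡ true × ∣ X ∣ + ∣ Y ∣ ≤ rank I + rk J Y)
  □-indep⇔ X Y rewrite □-++ X Y = ⇔.trans ∧≡true⇔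
    (mk⇔ (λ (iX , slack) → iX , Equivalence.to (slack⇔ iX) slack)
         (λ (iX , size) → iX , Equivalence.from (slack⇔ iX) size))
    where
    slack⇔ : I X ≡ true → (νₛ J Y ≤ᵇ λₛ I X) ≡ true ⇔ ∣ X ∣ + ∣ Y ∣ ≤ rank I + rk J Y
    slack⇔ iX rewrite indep⇒rk≡∣∣ I iX = ⇔.trans ≤ᵇ≡true⇔ (∸≤∸⇔+≤+ (indep⇒∣∣≤rank I iX))

module _ (I : SetSystem n) (i⊥ : I ⊥ ≡ true) where

  rk-Tr : Hereditary I → ∀ X → rk (Tr I) X ≡ rk I X ⊓ (rank I ∸ 1)
  rk-Tr hered X = ≤-antisym upper lower
    where
    upper : rk (Tr I) X ≤ rk I X ⊓ (rank I ∸ 1)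
    upper = rk-lub (Tr I) λ B tB B⊆X →
      let iB , B≤ = Equivalence.to (Tr-indep⇔ I) tB in ⊓-glb (indep⊆⇒∣∣≤rk I iB B⊆X) B≤
    lower : rk I X ⊓ (rank I ∸ 1) ≤ rk (Tr I) X
    lower with W , iW , W⊆X , ∣W∣≡rk ← rk-attained I i⊥ X
         with D , D⊆W , ∣D∣≡k ← ⊆-shrink (rk I X ⊓ (rank I ∸ 1)) (subst (_ ≤_) (sym ∣W∣≡rk) (m⊓n≤m _ _))
      = subst (_≤ rk (Tr I) X) ∣D∣≡k (indep⊆⇒∣∣≤rk (Tr I) tD (⊆-trans D⊆W W⊆X))
      where
      tD : Tr I D ≡ true
      tD = Equivalence.from (Tr-indep⇔ I) (hered D⊆W iW , subst (_≤ rank I ∸ 1) (sym ∣D∣≡k) (m⊓n≤n _ _))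

  rk-Lf : ∀ X → rk (Lf I) X ≡ (rk I X + 1) ⊓ ∣ X ∣
  rk-Lf X = ≤-antisym upper lower
    where
    upper : rk (Lf I) X ≤ (rk I X + 1) ⊓ ∣ X ∣
    upper = rk-lub (Lf I) λ B lB B⊆X →
      ⊓-glb (≤-trans (Equivalence.to (Lf-indep⇔ I) lB) (+-monoˡ-≤ 1 (rk-mono I B⊆X))) (p⊆q⇒∣p∣≤∣q∣ B⊆X)
    lower : (rk I X + 1) ⊓ ∣ X ∣ ≤ rk (Lf I) X
    lower with W , iW , W⊆X , ∣W∣≡rk ← rk-attained I i⊥ X
         with D , W⊆D , D⊆X , ∣D∣≡k ← ⊆-between ((rk I X + 1) ⊓ ∣ X ∣) W⊆X
                (⊓-glb (subst (_≤ rk I X + 1) (sym ∣W∣≡rk) (m≤m+n _ 1)) (p⊆q⇒∣p∣≤∣q∣ W⊆X)) (m⊓n≤n _ _)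
      = subst (_≤ rk (Lf I) X) ∣D∣≡k (indep⊆⇒∣∣≤rk (Lf I) (Equivalence.from (Lf-indep⇔ I) D≤) D⊆X)
      where
      open ≤-Reasoning
      D≤ : ∣ D ∣ ≤ rk I D + 1
      D≤ = begin
        ∣ D ∣                 ≡⟨ ∣D∣≡k ⟩
        (rk I X + 1) ⊓ ∣ X ∣  ≤⟨ m⊓n≤m _ _ ⟩
        rk I X + 1            ≡⟨ cong (_+ 1) ∣W∣≡rk ⟨
        ∣ W ∣ + 1             ≤⟨ +-monoˡ-≤ 1 (indep⊆⇒∣∣≤rk I iW W⊆D) ⟩
        rk I D + 1            ∎

module _ (I : SetSystem n) (J : SetSystem m) where

  private
    size≤rk-□ : ∀ {X Y X′ Y′ k} → I X′ ≡ true → X′ ⊆ X → Y′ ⊆ Y → ∣ X′ ∣ + ∣ Y′ ∣ ≡ k →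
                k ≤ rank I + rk J Y′ → k ≤ rk (I □ J) (X ++ᵥ Y)
    size≤rk-□ {X′ = X′} {Y′} iX′ X′⊆X Y′⊆Y refl k≤ =
      subst (_≤ _) (∣p++q∣≡∣p∣+∣q∣ X′ Y′)
        (indep⊆⇒∣∣≤rk (I □ J) (Equivalence.from (□-indep⇔ I J X′ Y′) (iX′ , k≤)) (++-⊆⁺ X′⊆X Y′⊆Y))

  rk-□-upper : ∀ X Y → rk (I □ J) (X ++ᵥ Y) ≤ (rk I X + ∣ Y ∣) ⊓ (rank I + rk J Y)
  rk-□-upper X Y = rk-lub (I □ J) (∀-++ bound)
    where
    bound : ∀ X′ Y′ → (I □ J) (X′ ++ᵥ Y′) ≡ true → X′ ++ᵥ Y′ ⊆ X ++ᵥ Y →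
            ∣ X′ ++ᵥ Y′ ∣ ≤ (rk I X + ∣ Y ∣) ⊓ (rank I + rk J Y)
    bound X′ Y′ X′Y′-indep X′Y′⊆XY
      with iX′ , size≤ ← Equivalence.to (□-indep⇔ I J X′ Y′) X′Y′-indep
         | X′⊆X , Y′⊆Y ← ++-⊆⁻ X′ X X′Y′⊆XY
      rewrite ∣p++q∣≡∣p∣+∣q∣ X′ Y′
      = ⊓-glb (+-mono-≤ (indep⊆⇒∣∣≤rk I iX′ X′⊆X) (p⊆q⇒∣p∣≤∣q∣ Y′⊆Y))
              (≤-trans size≤ (+-monoʳ-≤ (rank I) (rk-mono J Y′⊆Y)))

  -- The bound is attained by B ++ Y for a basis B of X; if that is too large, by D ++ Y for some D ⊆ B;
  -- and if Y alone is too large, by ⊥ ++ E for some E ⊆ Y containing a basis C of Y.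
  rk-□-lower : I ⊥ ≡ true → J ⊥ ≡ true → Hereditary I →
               ∀ X Y → (rk I X + ∣ Y ∣) ⊓ (rank I + rk J Y) ≤ rk (I □ J) (X ++ᵥ Y)
  rk-□-lower i⊥ j⊥ hered X Y with B , iB , B⊆X , ∣B∣≡r ← rk-attained I i⊥ X
                               with rk I X + ∣ Y ∣ ≤? rank I + rk J Y
  ... | yes r+b≤t = ≤-trans (m⊓n≤m _ _) (size≤rk-□ iB B⊆X ⊆-refl (cong (_+ ∣ Y ∣) ∣B∣≡r) r+b≤t)
  ... | no r+b≰t = ≤-trans (m⊓n≤n _ _) (t≤rk (∣ Y ∣ ≤? t))
    where
    t = rank I + rk J Y
    t∸b≤∣B∣ : t ∸ ∣ Y ∣ ≤ ∣ B ∣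
    t∸b≤∣B∣ = m≤n+o⇒m∸n≤o t ∣ Y ∣
      (subst (t ≤_) (trans (+-comm (rk I X) ∣ Y ∣) (cong (∣ Y ∣ +_) (sym ∣B∣≡r))) (<⇒≤ (≰⇒> r+b≰t)))
    t≤rk : Dec (∣ Y ∣ ≤ t) → t ≤ rk (I □ J) (X ++ᵥ Y)
    t≤rk (yes b≤t) with D , D⊆B , ∣D∣≡t∸b ← ⊆-shrink (t ∸ ∣ Y ∣) t∸b≤∣B∣
      = size≤rk-□ (hered D⊆B iB) (⊆-trans D⊆B B⊆X) ⊆-refl
          (trans (cong (_+ ∣ Y ∣) ∣D∣≡t∸b) (m∸n+n≡m b≤t)) ≤-refl
    t≤rk (no b≰t) with C , iC , C⊆Y , ∣C∣≡c ← rk-attained J j⊥ Y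
                  with E , C⊆E , E⊆Y , ∣E∣≡t ← ⊆-between t C⊆Y (subst (_≤ t) (sym ∣C∣≡c) (m≤n+m _ _))
                                                  (<⇒≤ (≰⇒> b≰t))
      = size≤rk-□ i⊥ ⊥⊆ E⊆Y (cong₂ _+_ (∣⊥∣≡0 n) ∣E∣≡t)
          (+-monoʳ-≤ (rank I) (subst (_≤ rk J E) ∣C∣≡c (indep⊆⇒∣∣≤rk J iC C⊆E)))

  rk-□ : I ⊥ ≡ true → J ⊥ ≡ true → Hereditary I →
         ∀ X Y → rk (I □ J) (X ++ᵥ Y) ≡ (rk I X + ∣ Y ∣) ⊓ (rank I + rk J Y)
  rk-□ i⊥ j⊥ hered X Y = ≤-antisym (rk-□-upper X Y) (rk-□-lower i⊥ j⊥ hered X Y)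

module FreeProduct (I : SetSystem n) (J : SetSystem m) (i⊥ : I ⊥ ≡ true) (j⊥ : J ⊥ ≡ true)
         (hered-I : Hereditary I) (hered-J : Hereditary J) where

  rank-□ : rank (I □ J) ≡ rank I + rank J
  rank-□ = begin
    rk (I □ J) ⊤                             ≡⟨ cong (rk (I □ J)) (⊤++⊤ n m) ⟨
    rk (I □ J) (⊤ {n} ++ᵥ ⊤ {m})             ≡⟨ rk-□ I J i⊥ j⊥ hered-I ⊤ ⊤ ⟩
    (rank I + ∣ ⊤ {m} ∣) ⊓ (rank I + rank J) ≡⟨ m≥n⇒m⊓n≡n (+-monoʳ-≤ (rank I) (rk≤∣∣ J ⊤)) ⟩
    rank I + rank J                          ∎
    where open ≡-Reasoning

  Tr-□-indep⇔ : ∀ X Y → Tr (I □ J) (X ++ᵥ Y) ≡ true ⇔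
                ((I X ≡ true × ∣ X ∣ + ∣ Y ∣ ≤ rank I + rk J Y) × ∣ X ∣ + ∣ Y ∣ ≤ rank I + rank J ∸ 1)
  Tr-□-indep⇔ X Y = ⇔.trans (Tr-indep⇔ (I □ J)) (□-indep⇔ I J X Y ×-⇔ size⇔)
    where
    size⇔ : ∣ X ++ᵥ Y ∣ ≤ rank (I □ J) ∸ 1 ⇔ ∣ X ∣ + ∣ Y ∣ ≤ rank I + rank J ∸ 1
    size⇔ rewrite ∣p++q∣≡∣p∣+∣q∣ X Y | rank-□ = ⇔.refl

  Tr-□-rank>0 : 0 < rank J → Tr (I □ J) ≐ (I □ Tr J)
  Tr-□-rank>0 ρ>0 = ≐-from-⇔ λ X Y →
    ⇔.trans (Tr-□-indep⇔ X Y) (⇔.trans (same X Y) (⇔.sym (□-indep⇔ I (Tr J) X Y)))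
    where
    same : ∀ X Y → ((I X ≡ true × ∣ X ∣ + ∣ Y ∣ ≤ rank I + rk J Y) × ∣ X ∣ + ∣ Y ∣ ≤ rank I + rank J ∸ 1)
                 ⇔ (I X ≡ true × ∣ X ∣ + ∣ Y ∣ ≤ rank I + rk (Tr J) Y)
    same X Y rewrite +-∸-assoc (rank I) ρ>0 | rk-Tr J j⊥ hered-J Y
                   | +-distribˡ-⊓ (rank I) (rk J Y) (rank J ∸ 1) =
      mk⇔ (λ ((iX , s≤) , s≤′) → iX , ⊓-glb s≤ s≤′)
          (λ (iX , s≤) → (iX , m≤n⊓o⇒m≤n _ _ s≤) , m≤n⊓o⇒m≤o _ _ s≤)

  Tr-□-rank≡0 : rank J ≡ 0 → Tr (I □ J) ≐ (Tr I □ J)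
  Tr-□-rank≡0 ρ≡0 = ≐-from-⇔ λ X Y →
    ⇔.trans (Tr-□-indep⇔ X Y) (⇔.trans (same X Y) (⇔.sym (□-indep⇔ (Tr I) J X Y)))
    where
    rk-J≡0 : ∀ Y → rk J Y ≡ 0
    rk-J≡0 Y = n≤0⇒n≡0 (subst (rk J Y ≤_) ρ≡0 (rk≤rank J Y))
    rank-Tr : rank (Tr I) ≡ rank I ∸ 1
    rank-Tr = trans (rk-Tr I i⊥ hered-I ⊤) (m≥n⇒m⊓n≡n (m∸n≤m (rank I) 1))
    same : ∀ X Y → ((I X ≡ true × ∣ X ∣ + ∣ Y ∣ ≤ rank I + rk J Y) × ∣ X ∣ + ∣ Y ∣ ≤ rank I + rank J ∸ 1)
                 ⇔ (Tr I X ≡ true × ∣ X ∣ + ∣ Y ∣ ≤ rank (Tr I) + rk J Y)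
    same X Y rewrite ρ≡0 | rk-J≡0 Y | rank-Tr | +-identityʳ (rank I) | +-identityʳ (rank I ∸ 1) =
      ⇔.trans (mk⇔ (λ ((iX , _) , s≤) → (iX , ≤-trans (m≤m+n _ _) s≤) , s≤)
                   (λ ((iX , _) , s≤) → (iX , ≤-trans s≤ (m∸n≤m (rank I) 1)) , s≤))
              (⇔.sym (Tr-indep⇔ I) ×-⇔ ⇔.refl)

  Lf-□-indep⇔ : ∀ X Y → Lf (I □ J) (X ++ᵥ Y) ≡ true ⇔
                (∣ X ∣ + ∣ Y ∣ ≤ rk I X + ∣ Y ∣ + 1 × ∣ X ∣ + ∣ Y ∣ ≤ rank I + rk J Y + 1)
  Lf-□-indep⇔ X Y = ⇔.trans (Lf-indep⇔ (I □ J)) size⇔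
    where
    size⇔ : ∣ X ++ᵥ Y ∣ ≤ rk (I □ J) (X ++ᵥ Y) + 1 ⇔
            (∣ X ∣ + ∣ Y ∣ ≤ rk I X + ∣ Y ∣ + 1 × ∣ X ∣ + ∣ Y ∣ ≤ rank I + rk J Y + 1)
    size⇔ rewrite rk-□ I J i⊥ j⊥ hered-I X Y | ∣p++q∣≡∣p∣+∣q∣ X Y =
      ≤⊓+⇔ (rk I X + ∣ Y ∣) (rank I + rk J Y) 1

  Lf-□-nullity>0 : 0 < nullity I → Lf (I □ J) ≐ (Lf I □ J)
  Lf-□-nullity>0 ν>0 = ≐-from-⇔ λ X Y →
    ⇔.trans (Lf-□-indep⇔ X Y) (⇔.trans (same X Y) (⇔.sym (□-indep⇔ (Lf I) J X Y)))
    where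
    rank+1≤∣⊤∣ : rank I + 1 ≤ ∣ ⊤ {n} ∣
    rank+1≤∣⊤∣ = subst₂ _≤_ (+-comm 1 (rank I)) (sym (∣⊤∣≡n n)) (m∸n≢0⇒n<m (>⇒≢ ν>0))
    rank-Lf : rank (Lf I) ≡ rank I + 1
    rank-Lf = trans (rk-Lf I i⊥ ⊤) (m≤n⇒m⊓n≡m rank+1≤∣⊤∣)
    same : ∀ X Y → (∣ X ∣ + ∣ Y ∣ ≤ rk I X + ∣ Y ∣ + 1 × ∣ X ∣ + ∣ Y ∣ ≤ rank I + rk J Y + 1)
                 ⇔ (Lf I X ≡ true × ∣ X ∣ + ∣ Y ∣ ≤ rank (Lf I) + rk J Y)
    same X Y rewrite rank-Lf | xy∙z≈xz∙y (rk I X) ∣ Y ∣ 1 | xy∙z≈xz∙y (rank I) (rk J Y) 1 =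
      ⇔.trans (mk⇔ (+-cancelʳ-≤ ∣ Y ∣ _ _) (+-monoˡ-≤ ∣ Y ∣)) (⇔.sym (Lf-indep⇔ I)) ×-⇔ ⇔.refl

  Lf-□-nullity≡0 : nullity I ≡ 0 → Lf (I □ J) ≐ (I □ Lf J)
  Lf-□-nullity≡0 ν≡0 = ≐-from-⇔ λ X Y →
    ⇔.trans (Lf-□-indep⇔ X Y) (⇔.trans (same X Y) (⇔.sym (□-indep⇔ I (Lf J) X Y)))
    where
    free : ∀ X → I X ≡ true
    free = nullity≡0⇒indep I i⊥ hered-I ν≡0
    same : ∀ X Y → (∣ X ∣ + ∣ Y ∣ ≤ rk I X + ∣ Y ∣ + 1 × ∣ X ∣ + ∣ Y ∣ ≤ rank I + rk J Y + 1)
                 ⇔ (I X ≡ true × ∣ X ∣ + ∣ Y ∣ ≤ rank I + rk (Lf J) Y)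
    same X Y rewrite rk-Lf J j⊥ Y | indep⇒rk≡∣∣ I (free X)
                   | +-distribˡ-⊓ (rank I) (rk J Y + 1) ∣ Y ∣ | +-assoc (rank I) (rk J Y) 1 =
      mk⇔ (λ (_ , s≤) → free X , ⊓-glb s≤ (+-monoˡ-≤ ∣ Y ∣ (indep⇒∣∣≤rank I (free X))))
          (λ (_ , s≤) → m≤m+n _ 1 , m≤n⊓o⇒m≤n _ _ s≤)

matroid-hereditary : (M : Matroid n) → Hereditary (indep M)
matroid-hereditary M {A} {B} = hereditary M A B

proposition5p4 : ∀ {n m} (M : Matroid n) (N : Matroid m) →
    ((0 < rank (indep N) → Tr (indep M □ indep N) ≐ (indep M □ Tr (indep N)))
     × (rank (indep N) ≡ 0 → Tr (indep M □ indep N) ≐ (Tr (indep M) □ indep N)))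
    × ((0 < nullity (indep M) → Lf (indep M □ indep N) ≐ (Lf (indep M) □ indep N))
     × (nullity (indep M) ≡ 0 → Lf (indep M □ indep N) ≐ (indep M □ Lf (indep N))))
proposition5p4 M N = (Tr-□-rank>0 , Tr-□-rank≡0) , (Lf-□-nullity>0 , Lf-□-nullity≡0)
  where
  open FreeProduct (indep M) (indep N) (indep-∅ M) (indep-∅ N)
                   (matroid-hereditary M) (matroid-hereditary N)
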